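{- For any natural numbers $m,n : \mathbb{N}$, if $m =_t n : \mathbb{N}$ is a computational path, then $t$ rewrites (via the rules of $LND_{EQ}$-$TRS$) to the reflexive path $\rho$.
   Context: $\mathbb{N}$ is the inductive type generated by $0:\mathbb{N}$ and $succ:\mathbb{N}\to\mathbb{N}$; its computational paths are all generated from the reflexive path $0 =_{\rho} 0$ by applications of the axioms and rules of the $\lambda\beta\eta$-equality theory. Computational paths: for terms $a,b$ of a type $A$, a computational path $a =_s b : A$ is a syntactic term recording a finite composition of rewrites, each an application of a rule of the equality theory: $(\rho)$ $M =_\rho M$; $(\sigma)$ symmetry $N =_{\sigma(r)} M$ from $M =_r N$; $(\tau)$ transitivity $M =_{\tau(r,s)} P$ from $M=_r N$, $N=_s P$; $(\beta)$, $(\eta)$; $(\mu)$ congruence of application in the argument ($f(x) =_{\mu_f(p)} f(y)$ from $x=_p y$); $(\nu)$ congruence in the function position; $(\xi)$ congruence under $\lambda$. Path terms are rewritten by the system $LND_{EQ}$-$TRS$, which includes: $\sigma(\rho)\rhd\rho$; $\tau(\rho,\rho)\rhd\rho$ (instances of $\tau(r,\rho)\rhd r$); $\mu_f(\rho_x)\rhd\rho_{f(x)}$; $\nu(\rho_x)\rhd\rho_{f(x)}$; $\xi(\rho)\rhd\rho$. -}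

module Defs where

open import Data.Nat using (ℕ; zero; suc)
open import Relation.Binary.Construct.Closure.ReflexiveTransitive using (Star)

-- Terms of type ℕ are the numerals 0, succ 0, succ (succ 0), ... (represented by ℕ).
-- Computational paths  m =_t n : ℕ  are syntactic path terms built by the rules
-- of the λβη-equality theory that can produce an equation between ℕ-terms:
-- ρ (reflexivity), σ (symmetry), τ (transitivity) and μ_succ (congruence of
-- the constructor succ applied to its argument).
data Path : ℕ → ℕ → Set where
  ρ     : {m : ℕ} → Path m m
  σ     : {m n : ℕ} → Path m n → Path n m
  τ     : {m n p : ℕ} → Path m n → Path n p → Path m p
  μsuc  : {m n : ℕ} → Path m n → Path (suc m) (suc n)

-- One-step rewriting of LND_EQ-TRS on path terms (the rules applicable to
-- these constructors), closed under congruence (rewriting of subterms).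
data _▷₁_ : {m n : ℕ} → Path m n → Path m n → Set where
  sr   : {m : ℕ} → σ (ρ {m}) ▷₁ ρ
  trr  : {m n : ℕ} (r : Path m n) → τ r ρ ▷₁ r
  tlr  : {m n : ℕ} (r : Path m n) → τ ρ r ▷₁ r
  mr   : {m : ℕ} → μsuc (ρ {m}) ▷₁ ρ
  σ-cong  : {m n : ℕ} {r r′ : Path m n} → r ▷₁ r′ → σ r ▷₁ σ r′
  τ-congˡ : {m n p : ℕ} {r r′ : Path m n} (s : Path n p) → r ▷₁ r′ → τ r s ▷₁ τ r′ s
  τ-congʳ : {m n p : ℕ} (r : Path m n) {s s′ : Path n p} → s ▷₁ s′ → τ r s ▷₁ τ r s′
  μ-cong  : {m n : ℕ} {r r′ : Path m n} → r ▷₁ r′ → μsuc r ▷₁ μsuc r′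

_▷_ : {m n : ℕ} → Path m n → Path m n → Set
_▷_ = Star _▷₁_

module Submission where

open import Defs
open import Data.Nat using (ℕ; suc)
open import Relation.Binary.PropositionalEquality using (_≡_; subst; sym; refl)
open import Data.Product using (Σ; _,_)
open import Relation.Binary.Construct.Closure.ReflexiveTransitive
  using (ε; _◅_; _◅◅_; gmap)

-- Every path term on ℕ is a loop (its endpoints are equal numerals), and by
-- induction on the term each loop collapses to ρ: once the immediate subterms
-- have been rewritten to ρ, one of the rules σ(ρ) ▷ ρ, τ(ρ,ρ) ▷ ρ or
-- μ_succ(ρ) ▷ ρ finishes the job.

σ-cong* : {m n : ℕ} {r r′ : Path m n} → r ▷ r′ → σ r ▷ σ r′
σ-cong* = gmap σ σ-cong

τ-congˡ* : {m n p : ℕ} {r r′ : Path m n} (s : Path n p) → r ▷ r′ → τ r s ▷ τ r′ s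
τ-congˡ* s = gmap (λ r → τ r s) (τ-congˡ s)

τ-congʳ* : {m n p : ℕ} (r : Path m n) {s s′ : Path n p} → s ▷ s′ → τ r s ▷ τ r s′
τ-congʳ* r = gmap (τ r) (τ-congʳ r)

μ-cong* : {m n : ℕ} {r r′ : Path m n} → r ▷ r′ → μsuc r ▷ μsuc r′
μ-cong* = gmap μsuc μ-cong

σ▷ρ : {m : ℕ} {r : Path m m} → r ▷ ρ → σ r ▷ ρ
σ▷ρ r▷ρ = σ-cong* r▷ρ ◅◅ sr ◅ ε

τ▷ρ : {m : ℕ} {r s : Path m m} → r ▷ ρ → s ▷ ρ → τ r s ▷ ρ
τ▷ρ {s = s} r▷ρ s▷ρ = τ-congˡ* s r▷ρ ◅◅ τ-congʳ* ρ s▷ρ ◅◅ trr ρ ◅ ε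

μsuc▷ρ : {m : ℕ} {r : Path m m} → r ▷ ρ → μsuc r ▷ ρ
μsuc▷ρ r▷ρ = μ-cong* r▷ρ ◅◅ mr ◅ ε

theorem2 : (m n : ℕ) (t : Path m n) →
    Σ (m ≡ n) (λ e → subst (Path m) (sym e) t ▷ ρ)
theorem2 m .m ρ = refl , ε
theorem2 m n (σ t) with theorem2 n m t
... | refl , t▷ρ = refl , σ▷ρ t▷ρ
theorem2 m n (τ {n = k} r s) with theorem2 m k r | theorem2 k n s
... | refl , r▷ρ | refl , s▷ρ = refl , τ▷ρ r▷ρ s▷ρ
theorem2 (suc m) (suc n) (μsuc t) with theorem2 m n t
... | refl , t▷ρ = refl , μsuc▷ρ t▷ρ
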